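{- Let $w\in S_n$ and suppose a node $u$ of the transition tree $\mathcal{T}(w)$ has exactly one child $u'$. Then $N_{2143,n}(u')\geq N_{2143,n}(u)$.
   Context: For $v\in S_n$, $N_{2143,n}(v)$ is the number of index tuples $i_1<i_2<i_3<i_4$ with $v(i_2)<v(i_1)<v(i_4)<v(i_3)$ (occurrences of the pattern $2143$). For $w\in S_n$, the Rothe diagram is $D(w)=\{(i,j): j<w(i),\ i<w^{ -1}(j)\}$ (matrix coordinates). The dominant component is the connected component (via edge-adjacency) of $D(w)$ containing $(1,1)$, if $(1,1)\in D(w)$. The essential set is $\{(i,j)\in D(w): (i+1,j),(i,j+1)\notin D(w)\}$. The accessible box is, among essential set boxes not in the dominant component, the one in the largest row, and among those the one in the largest column. $w$ is vexillary if $N_{2143,n}(w)=0$. The transition tree $\mathcal{T}(w)$ is the rooted tree with root labelled $w$ defined recursively: if $w$ is vexillary, the root is a leaf. Otherwise let $(x,y)$ be the accessible box, $x'=w^{ -1}(y)$, $y'=w(x)$. A pivot is an index $c<x$ with $w(c)<y$ such that no $c'$ with $c<c'<x$ has $w(c)<w(c')<y$. For each pivot $c$ the root has a child, the root of $\mathcal{T}(w^{(c)})$, where $w^{(c)}$ agrees with $w$ outside positions $c,x,x'$ and $w^{(c)}(c)=y$, $w^{(c)}(x)=w(c)$, $w^{(c)}(x')=y'$. Nodes of $\mathcal{T}(w)$ are identified with their labels. -}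

module Defs where

open import Data.Nat using (ℕ; zero; suc)
open import Data.Fin using (Fin; toℕ; _<_; _≤_; _<?_)
open import Data.Fin.Permutation using (Permutation; _⟨$⟩ʳ_; _⟨$⟩ˡ_; _≈_; _∘ₚ_; transpose)
open import Data.List using (List; length; filter; allFin; cartesianProduct)
open import Data.Product using (Σ; _×_; _,_)
open import Data.Sum using (_⊎_)
open import Relation.Nullary using (¬_)
open import Relation.Nullary.Decidable using (_×-dec_)
open import Relation.Binary.PropositionalEquality using (_≡_)

-- Permutations of [n] are stdlib permutations of Fin n (positions/values 0-indexed;
-- the order on Fin agrees with the order on [n]).
Perm : ℕ → Set
Perm n = Permutation n n

module _ {n : ℕ} where

  Quad : Set
  Quad = Fin n × Fin n × Fin n × Fin n

  quads : List Quad
  quads = cartesianProduct (allFin n)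
            (cartesianProduct (allFin n) (cartesianProduct (allFin n) (allFin n)))

  Occ2143 : Perm n → Quad → Set
  Occ2143 v (i₁ , i₂ , i₃ , i₄) =
    i₁ < i₂ × i₂ < i₃ × i₃ < i₄ ×
    (v ⟨$⟩ʳ i₂) < (v ⟨$⟩ʳ i₁) × (v ⟨$⟩ʳ i₁) < (v ⟨$⟩ʳ i₄) × (v ⟨$⟩ʳ i₄) < (v ⟨$⟩ʳ i₃)

  occ2143? : (v : Perm n) → (q : Quad) → Relation.Nullary.Dec (Occ2143 v q)
  occ2143? v (i₁ , i₂ , i₃ , i₄) =
    (i₁ <? i₂) ×-dec (i₂ <? i₃) ×-dec (i₃ <? i₄) ×-dec
    ((v ⟨$⟩ʳ i₂) <? (v ⟨$⟩ʳ i₁)) ×-dec ((v ⟨$⟩ʳ i₁) <? (v ⟨$⟩ʳ i₄)) ×-dec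
    ((v ⟨$⟩ʳ i₄) <? (v ⟨$⟩ʳ i₃))

  N2143 : Perm n → ℕ
  N2143 v = length (filter (occ2143? v) quads)

  Vexillary : Perm n → Set
  Vexillary w = N2143 w ≡ 0

  InD : Perm n → Fin n → Fin n → Set
  InD w i j = j < (w ⟨$⟩ʳ i) × i < (w ⟨$⟩ˡ j)

  Adjacent : Fin n → Fin n → Fin n → Fin n → Set
  Adjacent i j k l =
      (i ≡ k × (suc (toℕ j) ≡ toℕ l ⊎ suc (toℕ l) ≡ toℕ j))
    ⊎ (j ≡ l × (suc (toℕ i) ≡ toℕ k ⊎ suc (toℕ k) ≡ toℕ i))

  -- the dominant component: connected component of D(w) containing the box (1,1)
  -- (empty if (1,1) ∉ D(w))
  data Dominant (w : Perm n) : Fin n → Fin n → Set where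
    dom-base : ∀ i j → toℕ i ≡ 0 → toℕ j ≡ 0 → InD w i j → Dominant w i j
    dom-step : ∀ i j k l → Dominant w i j → Adjacent i j k l → InD w k l → Dominant w k l

  Essential : Perm n → Fin n → Fin n → Set
  Essential w i j =
    InD w i j ×
    (∀ k → toℕ k ≡ suc (toℕ i) → ¬ InD w k j) ×
    (∀ l → toℕ l ≡ suc (toℕ j) → ¬ InD w i l)

  Accessible : Perm n → Fin n → Fin n → Set
  Accessible w x y =
    Essential w x y × ¬ Dominant w x y ×
    (∀ i j → Essential w i j → ¬ Dominant w i j → (i < x ⊎ (i ≡ x × j ≤ y)))

  Pivot : Perm n → Fin n → Fin n → Fin n → Set
  Pivot w x y c =
    c < x × (w ⟨$⟩ʳ c) < y ×
    (∀ c' → c < c' → c' < x → ¬ ((w ⟨$⟩ʳ c) < (w ⟨$⟩ʳ c') × (w ⟨$⟩ʳ c') < y))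

  -- w^(c): agrees with w outside c, x, x' = w⁻¹(y);
  -- w^(c)(c) = y, w^(c)(x) = w(c), w^(c)(x') = w(x).
  -- As a function: w^(c) = w ∘ (c x) ∘ (c x')  (∘ₚ is diagrammatic composition).
  transition : Perm n → Fin n → Fin n → Fin n → Perm n
  transition w x y c = transpose c (w ⟨$⟩ˡ y) ∘ₚ transpose c x ∘ₚ w

  Child : Perm n → Perm n → Set
  Child u u' =
    ¬ Vexillary u ×
    Σ (Fin n) λ x → Σ (Fin n) λ y → Accessible u x y ×
    Σ (Fin n) λ c → Pivot u x y c × u' ≈ transition u x y c

  data Node (w : Perm n) : Perm n → Set where
    root  : Node w w
    child : ∀ {u u'} → Node w u → Child u u' → Node w u'

module Submission where

-- Let (x , y) be the accessible box of u, c its pivot and x′ = u⁻¹(y); then c < x < x′ and the child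
-- u^(c) is u with the values at c, x, x′ cycled (u(x′) moves to c, u(c) to x, u(x) to x′).
-- Distinct pivots give distinct children, so c is the only pivot. This forces every position strictly
-- between c and x to carry a value above y and every position before c a value outside (u(c) , y);
-- maximality of the accessible box forces u(k) < u(c) or u(i) < u(k) whenever x < i < k.
-- Under these constraints an occurrence of 2143 in u that is destroyed in u^(c) uses x or x′, and
-- replacing x by x′, or x by c and/or x′ by x, turns it into an occurrence created in u^(c).
-- Since the replacement can be undone, destroyed occurrences inject into created ones.

open import Defs
open import Level using (Level)
open import Data.Nat as ℕ using (ℕ; suc; z≤n; s≤s; _≥_)
import Data.Nat.Properties as ℕ
open import Data.Fin using (Fin; toℕ; _<_; _≤_; _>_; _<?_)
open import Data.Fin.Properties
  using (_≟_; <-trans; <-asym; <-irrefl; <-cmp; <⇒≢; ≤-refl; ≤-trans; ≤∧≢⇒<;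
         toℕ-injective; any?)
open import Data.Fin.Induction using (>-wellFounded)
open import Data.Fin.Permutation using (_⟨$⟩ʳ_; _⟨$⟩ˡ_; inverseˡ; inverseʳ; _≈_)
import Data.Fin.Permutation.Components as PC
open import Data.List using (List; []; _∷_; length; filter; map)
open import Data.List.Properties using (length-removeAt′; length-map; filter-≐)
open import Data.List.Relation.Unary.All as All using (All)
open import Data.List.Relation.Unary.Any as Any using (here; there; _─_)
open import Data.List.Relation.Unary.Unique.Propositional using (Unique; _∷_)
import Data.List.Relation.Unary.Unique.Propositional.Properties as Unique
open import Data.List.Membership.Propositional using (_∈_)
open import Data.List.Membership.Propositional.Properties
  using (∈-filter⁺; ∈-filter⁻; ∈-map⁺; ∈-cartesianProduct⁺; ∈-allFin)
open import Data.List.Relation.Binary.Subset.Propositional using (_⊆_)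
open import Data.Product using (∃; _×_; _,_; proj₁; proj₂)
open import Data.Sum as Sum using (_⊎_; inj₁; inj₂)
open import Data.Empty using (⊥-elim)
open import Function using (_∘_; _∘₂_)
open import Induction.WellFounded using (Acc; acc)
open import Relation.Nullary using (¬_; Dec; yes; no)
open import Relation.Nullary.Decidable using (_×-dec_; _⊎-dec_; dec-true; dec-false)
open import Relation.Unary using (Pred; Decidable)
open import Relation.Binary.Definitions using (tri<; tri≈; tri>)
open import Relation.Binary.PropositionalEquality

private
  variable
    a p q : Level
    n : ℕ

module _ {A : Set a} where

  ∈-─⁺ : ∀ {x z : A} {ys} (x∈ys : x ∈ ys) → z ≢ x → z ∈ ys → z ∈ (ys ─ x∈ys)
  ∈-─⁺ (here refl)  z≢x (here refl)  = ⊥-elim (z≢x refl)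
  ∈-─⁺ (here refl)  _   (there z∈ys) = z∈ys
  ∈-─⁺ (there x∈ys) _   (here refl)  = here refl
  ∈-─⁺ (there x∈ys) z≢x (there z∈ys) = there (∈-─⁺ x∈ys z≢x z∈ys)

  length-mono-⊆ : ∀ {xs ys : List A} → Unique xs → xs ⊆ ys → length xs ℕ.≤ length ys
  length-mono-⊆ {[]}     _            _     = z≤n
  length-mono-⊆ {x ∷ xs} {ys} (x∉xs ∷ xs!) xs⊆ys = begin
      suc (length xs)          ≤⟨ s≤s (length-mono-⊆ xs! xs⊆ys─x) ⟩
      suc (length (ys ─ x∈ys)) ≡⟨ length-removeAt′ ys (Any.index x∈ys) ⟨
      length ys                ∎
    where
      open ℕ.≤-Reasoning
      x∈ys : x ∈ ys
      x∈ys = xs⊆ys (here refl)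
      xs⊆ys─x : xs ⊆ (ys ─ x∈ys)
      xs⊆ys─x z∈xs = ∈-─⁺ x∈ys (λ z≡x → All.lookup x∉xs z∈xs (sym z≡x)) (xs⊆ys (there z∈xs))

  length-filter-≤ : {P : Pred A p} {Q : Pred A q} (P? : Decidable P) (Q? : Decidable Q)
    (g : A → A) {L : List A} → Unique L →
    (∀ {z} → z ∈ L → P z → ∃ λ z′ → z′ ∈ L × Q z′ × g z′ ≡ z) →
    length (filter P? L) ℕ.≤ length (filter Q? L)
  length-filter-≤ P? Q? g {L} L! cover = begin
      length (filter P? L)         ≤⟨ length-mono-⊆ (Unique.filter⁺ P? L!) covered ⟩
      length (map g (filter Q? L)) ≡⟨ length-map g (filter Q? L) ⟩
      length (filter Q? L)         ∎
    where
      open ℕ.≤-Reasoning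
      covered : filter P? L ⊆ map g (filter Q? L)
      covered z∈ with ∈-filter⁻ P? z∈
      ... | z∈L , Pz with cover z∈L Pz
      ...   | z′ , z′∈L , Qz′ , refl = ∈-map⁺ g (∈-filter⁺ Q? z′∈L Qz′)

transpose-matchˡ : (i j : Fin n) → PC.transpose i j i ≡ j
transpose-matchˡ i j rewrite dec-true (i ≟ i) refl = refl

transpose-matchʳ : (i j : Fin n) → PC.transpose i j j ≡ i
transpose-matchʳ i j with j ≟ i
... | yes j≡i = j≡i
... | no  _ rewrite dec-true (j ≟ j) refl = refl

transpose-unmatched : {i j k : Fin n} → k ≢ i → k ≢ j → PC.transpose i j k ≡ k
transpose-unmatched {i = i} {j} {k} k≢i k≢j
  rewrite dec-false (k ≟ i) k≢i | dec-false (k ≟ j) k≢j = refl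

>⇒≢ : {i j : Fin n} → i < j → j ≢ i
>⇒≢ i<j = <⇒≢ i<j ∘ sym

⟨$⟩ʳ-injective : (w : Perm n) {i j : Fin n} → w ⟨$⟩ʳ i ≡ w ⟨$⟩ʳ j → i ≡ j
⟨$⟩ʳ-injective w {i} {j} wi≡wj = begin
  i                       ≡⟨ inverseˡ w ⟨
  w ⟨$⟩ˡ (w ⟨$⟩ʳ i)      ≡⟨ cong (w ⟨$⟩ˡ_) wi≡wj ⟩
  w ⟨$⟩ˡ (w ⟨$⟩ʳ j)      ≡⟨ inverseˡ w ⟩
  j                       ∎
  where open ≡-Reasoning

module _ {P : Pred (Fin n) p} (P? : Decidable P) where

  LastBefore : Fin n → Fin n → Set p
  LastBefore i x = ∃ λ d → i ≤ d × d < x × P d × (∀ k → d < k → k < x → ¬ P k)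

  lastBefore : ∀ {i x} → i < x → P i → LastBefore i x
  lastBefore = go (>-wellFounded _)
    where
      go : ∀ {i x} → Acc _>_ i → i < x → P i → LastBefore i x
      go {i} {x} (acc rec) i<x Pi with any? (λ k → (i <? k) ×-dec (k <? x) ×-dec P? k)
      ... | yes (k , i<k , k<x , Pk) =
        let d , k≤d , rest = go (rec i<k) k<x Pk in d , ≤-trans (ℕ.<⇒≤ i<k) k≤d , rest
      ... | no none = i , ≤-refl , i<x , Pi , λ k i<k k<x Pk → none (k , i<k , k<x , Pk)

module _ (w : Perm n) where

  InD? : ∀ i j → Dec (InD w i j)
  InD? i j = (j <? w ⟨$⟩ʳ i) ×-dec (i <? w ⟨$⟩ˡ j)

  Dominant⇒rectangle : ∀ {i j} → Dominant w i j → ∀ {i′} → i′ ≤ i → j < w ⟨$⟩ʳ i′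
  Dominant⇒rectangle (dom-base i j i≡0 _ (j<wi , _)) {i′} i′≤i
    rewrite toℕ-injective {i = i′} {j = i} (ℕ.≤-antisym i′≤i (subst (ℕ._≤ toℕ i′) (sym i≡0) z≤n)) = j<wi
  Dominant⇒rectangle (dom-step i j _ l D (inj₁ (refl , inj₁ 1+j≡l)) (_ , i<w⁻¹l)) {i′} i′≤i =
    ≤∧≢⇒< (subst (ℕ._≤ _) 1+j≡l (Dominant⇒rectangle D i′≤i)) l≢wi′
    where
      l≢wi′ : l ≢ w ⟨$⟩ʳ i′
      l≢wi′ l≡wi′ = ℕ.<⇒≱ i<w⁻¹l (subst (λ k → toℕ k ℕ.≤ toℕ i) (sym w⁻¹l≡i′) i′≤i)
        where
          w⁻¹l≡i′ : w ⟨$⟩ˡ l ≡ i′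
          w⁻¹l≡i′ = trans (cong (w ⟨$⟩ˡ_) l≡wi′) (inverseˡ w)
  Dominant⇒rectangle (dom-step i j _ l D (inj₁ (refl , inj₂ 1+l≡j)) _) i′≤i =
    ℕ.<-trans (ℕ.≤-reflexive 1+l≡j) (Dominant⇒rectangle D i′≤i)
  Dominant⇒rectangle (dom-step i j k _ D (inj₂ (refl , inj₁ 1+i≡k)) (j<wk , _)) {i′} i′≤k
    with ℕ.m≤n⇒m<n∨m≡n i′≤k
  ... | inj₁ i′<k = Dominant⇒rectangle D (ℕ.≤-pred (subst (toℕ i′ ℕ.<_) (sym 1+i≡k) i′<k))
  ... | inj₂ i′≡k rewrite toℕ-injective {i = i′} {j = k} i′≡k = j<wk
  Dominant⇒rectangle (dom-step i j k _ D (inj₂ (refl , inj₂ 1+k≡i)) _) i′≤k =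
    Dominant⇒rectangle D (ℕ.≤-trans i′≤k (subst (toℕ k ℕ.≤_) 1+k≡i (ℕ.n≤1+n _)))

  -- Walk down, else right, inside D(w) until neither step is possible.
  ReachesEssential : Fin n → Fin n → Set
  ReachesEssential i j =
    ∃ λ e → ∃ λ f → i ≤ e × Essential w e f × (Dominant w e f → Dominant w i j)

  reachesEssential : ∀ {i j} → InD w i j → ReachesEssential i j
  reachesEssential = go (>-wellFounded _)
    where
      go : ∀ {i j} → Acc _>_ i → InD w i j → ReachesEssential i j
      go {i} (acc recᵢ) = goRight (>-wellFounded _)
        where
          goRight : ∀ {j} → Acc _>_ j → InD w i j → ReachesEssential i j
          goRight {j} (acc recⱼ) ij∈D with any? (λ k → (toℕ k ℕ.≟ suc (toℕ i)) ×-dec InD? k j)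
          ... | yes (k , k≡1+i , kj∈D) =
            let e , f , k≤e , ess , back = go (recᵢ (ℕ.≤-reflexive (sym k≡1+i))) kj∈D
            in e , f , ℕ.≤-trans (ℕ.n≤1+n _) (subst (ℕ._≤ toℕ e) k≡1+i k≤e) , ess ,
               λ Def → dom-step k j i j (back Def) (inj₂ (refl , inj₂ (sym k≡1+i))) ij∈D
          ... | no ¬below with any? (λ l → (toℕ l ℕ.≟ suc (toℕ j)) ×-dec InD? i l)
          ...   | yes (l , l≡1+j , il∈D) =
            let e , f , i≤e , ess , back = goRight (recⱼ (ℕ.≤-reflexive (sym l≡1+j))) il∈D
            in e , f , i≤e , ess , λ Def → dom-step i l i j (back Def) (inj₁ (refl , inj₂ (sym l≡1+j))) ij∈D
          ...   | no ¬right =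
            i , j , ≤-refl ,
            (ij∈D , (λ k k≡1+i kj∈D → ¬below (k , k≡1+i , kj∈D))
                  , (λ l l≡1+j il∈D → ¬right (l , l≡1+j , il∈D))) ,
            λ Dij → Dij

module _ (u : Perm n) (x y c : Fin n) where

  private
    x′ : Fin n
    x′ = u ⟨$⟩ˡ y

  transition-at-pivot : x′ ≢ c → x′ ≢ x → transition u x y c ⟨$⟩ʳ c ≡ u ⟨$⟩ʳ x′
  transition-at-pivot x′≢c x′≢x
    rewrite transpose-matchˡ c x′ | transpose-unmatched x′≢c x′≢x = refl

  transition-at-x : x ≢ c → x ≢ x′ → transition u x y c ⟨$⟩ʳ x ≡ u ⟨$⟩ʳ c
  transition-at-x x≢c x≢x′
    rewrite transpose-unmatched {i = c} x≢c x≢x′ | transpose-matchʳ c x = refl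

  transition-at-x′ : transition u x y c ⟨$⟩ʳ x′ ≡ u ⟨$⟩ʳ x
  transition-at-x′ rewrite transpose-matchʳ c x′ | transpose-matchˡ c x = refl

  transition-elsewhere : ∀ {i} → i ≢ c → i ≢ x → i ≢ x′ → transition u x y c ⟨$⟩ʳ i ≡ u ⟨$⟩ʳ i
  transition-elsewhere i≢c i≢x i≢x′
    rewrite transpose-unmatched i≢c i≢x′ | transpose-unmatched i≢c i≢x = refl

transition-injective : (u : Perm n) {x y c d : Fin n} → c < x → d < x → x < u ⟨$⟩ˡ y →
  transition u x y d ≈ transition u x y c → d ≡ c
transition-injective u {x} {y} {c} {d} c<x d<x x<x′ same with d ≟ c
... | yes d≡c = d≡c
... | no  d≢c = ⊥-elim (>⇒≢ d<x′ (⟨$⟩ʳ-injective u (begin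
    u ⟨$⟩ʳ (u ⟨$⟩ˡ y)          ≡⟨ transition-at-pivot u x y d (>⇒≢ d<x′) (>⇒≢ x<x′) ⟨
    transition u x y d ⟨$⟩ʳ d  ≡⟨ same d ⟩
    transition u x y c ⟨$⟩ʳ d  ≡⟨ transition-elsewhere u x y c d≢c (<⇒≢ d<x) (<⇒≢ d<x′) ⟩
    u ⟨$⟩ʳ d                   ∎)))
  where
    open ≡-Reasoning
    d<x′ : d < u ⟨$⟩ˡ y
    d<x′ = <-trans d<x x<x′

module OnlyPivot (u : Perm n) {x y c : Fin n} (accessible : Accessible u x y) (piv : Pivot u x y c)
                 (onlyPivot : ∀ {d} → Pivot u x y d → d ≡ c) where

  x′ : Fin n
  x′ = u ⟨$⟩ˡ y

  c<x : c < x
  c<x = proj₁ piv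

  uc<y : u ⟨$⟩ʳ c < y
  uc<y = proj₁ (proj₂ piv)

  y<ux : y < u ⟨$⟩ʳ x
  y<ux = proj₁ (proj₁ (proj₁ accessible))

  x<x′ : x < x′
  x<x′ = proj₂ (proj₁ (proj₁ accessible))

  private
    y-only-at-x′ : ∀ {i} → y ≡ u ⟨$⟩ʳ i → x′ ≡ i
    y-only-at-x′ y≡ui = trans (cong (u ⟨$⟩ˡ_) y≡ui) (inverseˡ u)

    not-pivot : ∀ {d} → d < c → ¬ Pivot u x y d
    not-pivot d<c pd = <-irrefl (onlyPivot pd) d<c

  between-pivot-and-x : ∀ {i} → c < i → i < x → y < u ⟨$⟩ʳ i
  between-pivot-and-x {i} c<i i<x with <-cmp y (u ⟨$⟩ʳ i)
  ... | tri< y<ui _ _ = y<ui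
  ... | tri≈ _ y≡ui _ = ⊥-elim (>⇒≢ (<-trans i<x x<x′) (y-only-at-x′ y≡ui))
  ... | tri> _ _ ui<y with lastBefore (λ k → u ⟨$⟩ʳ k <? y) i<x ui<y
  ...   | d , i≤d , d<x , ud<y , last =
    ⊥-elim (<-irrefl (sym (onlyPivot (d<x , ud<y , λ k d<k k<x (_ , uk<y) → last k d<k k<x uk<y)))
                     (ℕ.<-≤-trans c<i i≤d))

  before-pivot : ∀ {i} → i < c → u ⟨$⟩ʳ i < u ⟨$⟩ʳ c ⊎ y < u ⟨$⟩ʳ i
  before-pivot {i} i<c with <-cmp (u ⟨$⟩ʳ i) (u ⟨$⟩ʳ c)
  ... | tri< ui<uc _ _ = inj₁ ui<uc
  ... | tri≈ _ ui≡uc _ = ⊥-elim (<⇒≢ i<c (⟨$⟩ʳ-injective u ui≡uc))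
  ... | tri> _ _ uc<ui with <-cmp y (u ⟨$⟩ʳ i)
  ...   | tri< y<ui _ _ = inj₂ y<ui
  ...   | tri≈ _ y≡ui _ = ⊥-elim (>⇒≢ (<-trans i<c (<-trans c<x x<x′)) (y-only-at-x′ y≡ui))
  ...   | tri> _ _ ui<y
    with lastBefore (λ k → (u ⟨$⟩ʳ c <? u ⟨$⟩ʳ k) ×-dec (u ⟨$⟩ʳ k <? y)) i<c (uc<ui , ui<y)
  ...     | d , _ , d<c , (uc<ud , ud<y) , last = ⊥-elim (not-pivot d<c (<-trans d<c c<x , ud<y , nothing-between))
    where
      nothing-between : ∀ k → d < k → k < x → ¬ (u ⟨$⟩ʳ d < u ⟨$⟩ʳ k × u ⟨$⟩ʳ k < y)
      nothing-between k d<k k<x (ud<uk , uk<y) with <-cmp k c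
      ... | tri< k<c _ _ = last k d<k k<c (<-trans uc<ud ud<uk , uk<y)
      ... | tri≈ _ refl _ = <-asym uc<ud ud<uk
      ... | tri> _ _ c<k = <-asym uk<y (between-pivot-and-x c<k k<x)

  -- Otherwise (i , u k) would lie in D(u) below row x, and walking to an essential box would contradict accessibility.
  after-x : ∀ {i k} → x < i → i < k → u ⟨$⟩ʳ k < u ⟨$⟩ʳ c ⊎ u ⟨$⟩ʳ i < u ⟨$⟩ʳ k
  after-x {i} {k} x<i i<k with <-cmp (u ⟨$⟩ʳ k) (u ⟨$⟩ʳ c)
  ... | tri< uk<uc _ _ = inj₁ uk<uc
  ... | tri≈ _ uk≡uc _ = ⊥-elim (>⇒≢ (<-trans c<x (<-trans x<i i<k)) (⟨$⟩ʳ-injective u uk≡uc))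
  ... | tri> _ _ uc<uk with <-cmp (u ⟨$⟩ʳ i) (u ⟨$⟩ʳ k)
  ...   | tri< ui<uk _ _ = inj₂ ui<uk
  ...   | tri≈ _ ui≡uk _ = ⊥-elim (<⇒≢ i<k (⟨$⟩ʳ-injective u ui≡uk))
  ...   | tri> _ _ uk<ui
    with reachesEssential u (uk<ui , subst (i <_) (sym (inverseˡ u)) i<k)
  ...     | e , f , i≤e , ess , back
    with proj₂ (proj₂ accessible) e f ess (λ Def → <-asym uc<uk (Dominant⇒rectangle u (back Def) c≤i))
    where
      c≤i : c ≤ i
      c≤i = ℕ.<⇒≤ (<-trans c<x x<i)
  ...       | inj₁ e<x        = ⊥-elim (<-asym e<x (ℕ.<-≤-trans x<i i≤e))
  ...       | inj₂ (refl , _) = ⊥-elim (<-irrefl refl (ℕ.<-≤-trans x<i i≤e))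

quads-unique : Unique (quads {n})
quads-unique {n} =
  Unique.cartesianProduct⁺ (Unique.allFin⁺ n)
    (Unique.cartesianProduct⁺ (Unique.allFin⁺ n) (Unique.cartesianProduct⁺ (Unique.allFin⁺ n) (Unique.allFin⁺ n)))

∈-quads : (q : Quad {n}) → q ∈ quads
∈-quads (p₁ , p₂ , p₃ , p₄) =
  ∈-cartesianProduct⁺ (∈-allFin p₁)
    (∈-cartesianProduct⁺ (∈-allFin p₂) (∈-cartesianProduct⁺ (∈-allFin p₃) (∈-allFin p₄)))

_∈Q_ : Fin n → Quad {n} → Set
i ∈Q (p₁ , p₂ , p₃ , p₄) = i ≡ p₁ ⊎ i ≡ p₂ ⊎ i ≡ p₃ ⊎ i ≡ p₄

_∈Q?_ : (i : Fin n) (q : Quad {n}) → Dec (i ∈Q q)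
i ∈Q? (p₁ , p₂ , p₃ , p₄) = (i ≟ p₁) ⊎-dec (i ≟ p₂) ⊎-dec (i ≟ p₃) ⊎-dec (i ≟ p₄)

∉Q : ∀ {i p₁ p₂ p₃ p₄ : Fin n} → i ≢ p₁ → i ≢ p₂ → i ≢ p₃ → i ≢ p₄ → ¬ i ∈Q (p₁ , p₂ , p₃ , p₄)
∉Q i≢p₁ _ _ _ (inj₁ i≡p₁)                   = i≢p₁ i≡p₁
∉Q _ i≢p₂ _ _ (inj₂ (inj₁ i≡p₂))            = i≢p₂ i≡p₂
∉Q _ _ i≢p₃ _ (inj₂ (inj₂ (inj₁ i≡p₃)))     = i≢p₃ i≡p₃
∉Q _ _ _ i≢p₄ (inj₂ (inj₂ (inj₂ i≡p₄)))     = i≢p₄ i≡p₄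

mapQ : (Fin n → Fin n) → Quad {n} → Quad {n}
mapQ f (p₁ , p₂ , p₃ , p₄) = f p₁ , f p₂ , f p₃ , f p₄

quad-cong : ∀ {p₁ p₂ p₃ p₄ q₁ q₂ q₃ q₄ : Fin n} → p₁ ≡ q₁ → p₂ ≡ q₂ → p₃ ≡ q₃ → p₄ ≡ q₄ →
            (p₁ , p₂ , p₃ , p₄) ≡ (q₁ , q₂ , q₃ , q₄)
quad-cong refl refl refl refl = refl

transport-< : ∀ {i i′ j j′ : Fin n} → i ≡ i′ → j ≡ j′ → i′ < j′ → i < j
transport-< refl refl i′<j′ = i′<j′

module ValueCycle (u v : Perm n) {c x x′ : Fin n} (c<x : c < x) (x<x′ : x < x′)
  (v-c  : v ⟨$⟩ʳ c ≡ u ⟨$⟩ʳ x′) (v-x : v ⟨$⟩ʳ x ≡ u ⟨$⟩ʳ c) (v-x′ : v ⟨$⟩ʳ x′ ≡ u ⟨$⟩ʳ x)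
  (v-elsewhere : ∀ {i} → i ≢ c → i ≢ x → i ≢ x′ → v ⟨$⟩ʳ i ≡ u ⟨$⟩ʳ i)
  (uc<ux′ : u ⟨$⟩ʳ c < u ⟨$⟩ʳ x′) (ux′<ux : u ⟨$⟩ʳ x′ < u ⟨$⟩ʳ x)
  (between : ∀ {i} → c < i → i < x → u ⟨$⟩ʳ x′ < u ⟨$⟩ʳ i)
  (before  : ∀ {i} → i < c → u ⟨$⟩ʳ i < u ⟨$⟩ʳ c ⊎ u ⟨$⟩ʳ x′ < u ⟨$⟩ʳ i)
  (after   : ∀ {i k} → x < i → i < k → u ⟨$⟩ʳ k < u ⟨$⟩ʳ c ⊎ u ⟨$⟩ʳ i < u ⟨$⟩ʳ k) where

  private
    U V : Fin n → Fin n
    U i = u ⟨$⟩ʳ i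
    V i = v ⟨$⟩ʳ i

    c<x′ : c < x′
    c<x′ = <-trans c<x x<x′

    uc<ux : U c < U x
    uc<ux = <-trans uc<ux′ ux′<ux

    positions-differ : ∀ {i j} → U i < U j → i ≢ j
    positions-differ ui<uj refl = <-irrefl refl ui<uj

  v≡u-before-x : ∀ {p} → p ≢ c → p < x → V p ≡ U p
  v≡u-before-x p≢c p<x = v-elsewhere p≢c (<⇒≢ p<x) (<⇒≢ (<-trans p<x x<x′))

  v≡u-after-x : ∀ {p} → p ≢ x′ → x < p → V p ≡ U p
  v≡u-after-x p≢x′ x<p = v-elsewhere (>⇒≢ (<-trans c<x x<p)) (>⇒≢ x<p) p≢x′

  v≡u-after-x′ : ∀ {p} → x′ < p → V p ≡ U p
  v≡u-after-x′ x′<p = v≡u-after-x (>⇒≢ x′<p) (<-trans x<x′ x′<p)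

  v≡u-below-uc : ∀ {p} → U p < U c → V p ≡ U p
  v≡u-below-uc up<uc =
    v-elsewhere (positions-differ up<uc) (positions-differ (<-trans up<uc uc<ux))
                (positions-differ (<-trans up<uc uc<ux′))

  before-x : ∀ {p} → p < x → p ≢ c → U p < U c ⊎ U x′ < U p
  before-x {p} p<x p≢c with <-cmp p c
  ... | tri< p<c _ _ = before p<c
  ... | tri≈ _ p≡c _ = ⊥-elim (p≢c p≡c)
  ... | tri> _ _ c<p = inj₂ (between c<p p<x)

  above-uc-before-x : ∀ {p} → p < x → p ≢ c → U c < U p → U x′ < U p
  above-uc-before-x p<x p≢c uc<up with before-x p<x p≢c
  ... | inj₁ up<uc  = ⊥-elim (<-asym up<uc uc<up)
  ... | inj₂ ux′<up = ux′<up

  below-ux′-between-x-and-x′ : ∀ {p} → x < p → p < x′ → U p < U x′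
  below-ux′-between-x-and-x′ x<p p<x′ with after x<p p<x′
  ... | inj₁ ux′<uc = ⊥-elim (<-asym ux′<uc uc<ux′)
  ... | inj₂ up<ux′ = up<ux′

  below-uc-before-x : ∀ {p} → p < x → p ≢ c → U p < U x′ → U p < U c
  below-uc-before-x p<x p≢c up<ux′ with before-x p<x p≢c
  ... | inj₁ up<uc  = up<uc
  ... | inj₂ ux′<up = ⊥-elim (<-asym up<ux′ ux′<up)

  -- A replacement either puts x′ in place of x, or puts c in place of x and/or x in place of x′;
  -- its quadruple contains x′ exactly in the first case.
  unswap unshift : Fin n → Fin n
  unswap  = PC.transpose x′ x
  unshift = PC.transpose c x ∘ PC.transpose x x′

  unrepair : Quad {n} → Quad {n}
  unrepair q with x′ ∈Q? q
  ... | yes _ = mapQ unswap q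
  ... | no  _ = mapQ unshift q

  unrepair-∋x′ : ∀ {q} → x′ ∈Q q → unrepair q ≡ mapQ unswap q
  unrepair-∋x′ {q} x′∈q with x′ ∈Q? q
  ... | yes _   = refl
  ... | no  x′∉q = ⊥-elim (x′∉q x′∈q)

  unrepair-∌x′ : ∀ {q} → ¬ x′ ∈Q q → unrepair q ≡ mapQ unshift q
  unrepair-∌x′ {q} x′∉q with x′ ∈Q? q
  ... | yes x′∈q = ⊥-elim (x′∉q x′∈q)
  ... | no  _    = refl

  unswap-x′ : unswap x′ ≡ x
  unswap-x′ = transpose-matchˡ x′ x

  unswap-fixes : ∀ {p} → p ≢ x′ → p ≢ x → unswap p ≡ p
  unswap-fixes = transpose-unmatched

  unshift-c : unshift c ≡ x
  unshift-c rewrite transpose-unmatched {i = x} (<⇒≢ c<x) (<⇒≢ c<x′) = transpose-matchˡ c x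

  unshift-x : unshift x ≡ x′
  unshift-x rewrite transpose-matchˡ x x′ = transpose-unmatched (>⇒≢ c<x′) (>⇒≢ x<x′)

  unshift-fixes : ∀ {p} → p ≢ c → p ≢ x → p ≢ x′ → unshift p ≡ p
  unshift-fixes p≢c p≢x p≢x′ rewrite transpose-unmatched {i = x} p≢x p≢x′ = transpose-unmatched p≢c p≢x

  unswap-fixes-before-x : ∀ {p} → p < x → unswap p ≡ p
  unswap-fixes-before-x p<x = unswap-fixes (<⇒≢ (<-trans p<x x<x′)) (<⇒≢ p<x)

  unswap-fixes-after-x′ : ∀ {p} → x′ < p → unswap p ≡ p
  unswap-fixes-after-x′ x′<p = unswap-fixes (>⇒≢ x′<p) (>⇒≢ (<-trans x<x′ x′<p))

  unshift-fixes-before-x : ∀ {p} → p ≢ c → p < x → unshift p ≡ p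
  unshift-fixes-before-x p≢c p<x = unshift-fixes p≢c (<⇒≢ p<x) (<⇒≢ (<-trans p<x x<x′))

  x′∉Q : ∀ {p₁ p₂ p₃ p₄} → p₁ < x′ → p₂ < x′ → p₃ < x′ → p₄ < x′ → ¬ x′ ∈Q (p₁ , p₂ , p₃ , p₄)
  x′∉Q p₁<x′ p₂<x′ p₃<x′ p₄<x′ = ∉Q (>⇒≢ p₁<x′) (>⇒≢ p₂<x′) (>⇒≢ p₃<x′) (>⇒≢ p₄<x′)

  before-pivot-if-below-ux′ : ∀ {p} → p < x → p ≢ c → U p < U x′ → p < c
  before-pivot-if-below-ux′ {p} p<x p≢c up<ux′ with <-cmp p c
  ... | tri< p<c _ _ = p<c
  ... | tri≈ _ p≡c _ = ⊥-elim (p≢c p≡c)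
  ... | tri> _ _ c<p = ⊥-elim (<-asym up<ux′ (between c<p p<x))

  record Replacement (q : Quad {n}) : Set where
    field
      quad        : Quad {n}
      occurs-in-v : Occ2143 v quad
      not-in-u    : ¬ Occ2143 u quad
      restores    : unrepair quad ≡ q

  Outcome : Quad {n} → Set
  Outcome q = Occ2143 v q ⊎ Replacement q

  preserved-before-x : ∀ {p₁ p₂ p₃ p₄} → p₄ < x →
    Occ2143 u (p₁ , p₂ , p₃ , p₄) → Occ2143 v (p₁ , p₂ , p₃ , p₄)
  preserved-before-x {p₁} {p₂} {p₃} {p₄} p₄<x (p₁<p₂ , p₂<p₃ , p₃<p₄ , u₂<u₁ , u₁<u₄ , u₄<u₃)
    with p₁ ≟ c | p₂ ≟ c | p₃ ≟ c | p₄ ≟ c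
  ... | yes refl | _ | _ | _ =
    ⊥-elim (<-asym (<-trans u₂<u₁ uc<ux′) (between p₁<p₂ (<-trans p₂<p₃ (<-trans p₃<p₄ p₄<x))))
  ... | no p₁≢c | yes refl | _ | _ =
    p₁<p₂ , p₂<p₃ , p₃<p₄ ,
    transport-< v-c v₁ (above-uc-before-x p₁<x p₁≢c u₂<u₁) ,
    transport-< v₁ v₄ u₁<u₄ ,
    transport-< v₄ (v≡u-before-x (>⇒≢ p₂<p₃) p₃<x) u₄<u₃
    where
      p₃<x : p₃ < x
      p₃<x = <-trans p₃<p₄ p₄<x
      p₁<x : p₁ < x
      p₁<x = <-trans p₁<p₂ (<-trans p₂<p₃ p₃<x)
      v₁ : V p₁ ≡ U p₁
      v₁ = v≡u-before-x p₁≢c p₁<x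
      v₄ : V p₄ ≡ U p₄
      v₄ = v≡u-before-x (>⇒≢ (<-trans p₂<p₃ p₃<p₄)) p₄<x
  ... | no p₁≢c | no p₂≢c | yes refl | _ =
    p₁<p₂ , p₂<p₃ , p₃<p₄ ,
    transport-< v₂ v₁ u₂<u₁ ,
    transport-< v₁ v₄ u₁<u₄ ,
    transport-< v₄ v-c (<-trans u₄<u₃ uc<ux′)
    where
      p₂<x : p₂ < x
      p₂<x = <-trans p₂<p₃ c<x
      v₁ : V p₁ ≡ U p₁
      v₁ = v≡u-before-x p₁≢c (<-trans p₁<p₂ p₂<x)
      v₂ : V p₂ ≡ U p₂
      v₂ = v≡u-before-x p₂≢c p₂<x
      v₄ : V p₄ ≡ U p₄
      v₄ = v≡u-before-x (>⇒≢ p₃<p₄) p₄<x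
  ... | no p₁≢c | no p₂≢c | no p₃≢c | yes refl =
    p₁<p₂ , p₂<p₃ , p₃<p₄ ,
    transport-< v₂ v₁ u₂<u₁ ,
    transport-< v₁ v-c (<-trans u₁<u₄ uc<ux′) ,
    transport-< v-c v₃ (above-uc-before-x p₃<x p₃≢c u₄<u₃)
    where
      p₃<x : p₃ < x
      p₃<x = <-trans p₃<p₄ c<x
      p₂<x : p₂ < x
      p₂<x = <-trans p₂<p₃ p₃<x
      v₁ : V p₁ ≡ U p₁
      v₁ = v≡u-before-x p₁≢c (<-trans p₁<p₂ p₂<x)
      v₂ : V p₂ ≡ U p₂
      v₂ = v≡u-before-x p₂≢c p₂<x
      v₃ : V p₃ ≡ U p₃
      v₃ = v≡u-before-x p₃≢c p₃<x
  ... | no p₁≢c | no p₂≢c | no p₃≢c | no p₄≢c =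
    p₁<p₂ , p₂<p₃ , p₃<p₄ ,
    transport-< v₂ v₁ u₂<u₁ ,
    transport-< v₁ v₄ u₁<u₄ ,
    transport-< v₄ v₃ u₄<u₃
    where
      p₃<x : p₃ < x
      p₃<x = <-trans p₃<p₄ p₄<x
      p₂<x : p₂ < x
      p₂<x = <-trans p₂<p₃ p₃<x
      v₁ : V p₁ ≡ U p₁
      v₁ = v≡u-before-x p₁≢c (<-trans p₁<p₂ p₂<x)
      v₂ : V p₂ ≡ U p₂
      v₂ = v≡u-before-x p₂≢c p₂<x
      v₃ : V p₃ ≡ U p₃
      v₃ = v≡u-before-x p₃≢c p₃<x
      v₄ : V p₄ ≡ U p₄
      v₄ = v≡u-before-x p₄≢c p₄<x

  below-uc-stays-below-after-x : ∀ {p} {w} → x < p → w < U c → w < U p → w < V p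
  below-uc-stays-below-after-x {p} x<p w<uc w<up with p ≟ x′
  ... | yes refl = transport-< refl v-x′ (<-trans w<uc uc<ux)
  ... | no p≢x′  = transport-< refl (v≡u-after-x p≢x′ x<p) w<up

  preserved-after-x : ∀ {p₁ p₂ p₃ p₄} → x < p₃ →
    Occ2143 u (p₁ , p₂ , p₃ , p₄) → Occ2143 v (p₁ , p₂ , p₃ , p₄)
  preserved-after-x {p₁} {p₂} {p₃} {p₄} x<p₃ (p₁<p₂ , p₂<p₃ , p₃<p₄ , u₂<u₁ , u₁<u₄ , u₄<u₃)
    with after x<p₃ p₃<p₄
  ... | inj₂ u₃<u₄ = ⊥-elim (<-asym u₃<u₄ u₄<u₃)
  ... | inj₁ u₄<uc =
    p₁<p₂ , p₂<p₃ , p₃<p₄ ,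
    transport-< (v≡u-below-uc (<-trans u₂<u₁ u₁<uc)) v₁ u₂<u₁ ,
    transport-< v₁ v₄ u₁<u₄ ,
    transport-< v₄ refl (below-uc-stays-below-after-x x<p₃ u₄<uc u₄<u₃)
    where
      u₁<uc : U p₁ < U c
      u₁<uc = <-trans u₁<u₄ u₄<uc
      v₁ : V p₁ ≡ U p₁
      v₁ = v≡u-below-uc u₁<uc
      v₄ : V p₄ ≡ U p₄
      v₄ = v≡u-below-uc u₄<uc

  outcome-x-as-3 : ∀ {p₁ p₂ p₃} → Occ2143 u (p₁ , p₂ , p₃ , x) → Outcome (p₁ , p₂ , p₃ , x)
  outcome-x-as-3 {p₁} {p₂} {p₃} (p₁<p₂ , p₂<p₃ , p₃<x , u₂<u₁ , u₁<ux , ux<u₃)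
    with p₁ ≟ c | p₂ ≟ c | p₃ ≟ c
  ... | yes refl | _ | _ = ⊥-elim (<-asym (<-trans u₂<u₁ uc<ux′) (between p₁<p₂ (<-trans p₂<p₃ p₃<x)))
  ... | no _ | no _ | yes refl = ⊥-elim (<-asym ux<u₃ uc<ux)
  ... | no p₁≢c | yes refl | _ with before p₁<p₂
  ...   | inj₁ u₁<uc  = ⊥-elim (<-asym u₁<uc u₂<u₁)
  ...   | inj₂ ux′<u₁ = inj₂ record
    { quad        = p₁ , c , p₃ , x′
    ; occurs-in-v = p₁<p₂ , p₂<p₃ , <-trans p₃<x x<x′ ,
                    transport-< v-c v₁ ux′<u₁ , transport-< v₁ v-x′ u₁<ux , transport-< v-x′ v₃ ux<u₃
    ; not-in-u    = λ (_ , _ , _ , _ , u₁<ux′ , _) → <-asym u₁<ux′ ux′<u₁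
    ; restores    = trans (unrepair-∋x′ (inj₂ (inj₂ (inj₂ refl))))
                          (quad-cong (unswap-fixes-before-x p₁<x) (unswap-fixes-before-x c<x)
                                     (unswap-fixes-before-x p₃<x) unswap-x′)
    }
    where
      p₁<x : p₁ < x
      p₁<x = <-trans p₁<p₂ c<x
      v₁ : V p₁ ≡ U p₁
      v₁ = v≡u-before-x p₁≢c p₁<x
      v₃ : V p₃ ≡ U p₃
      v₃ = v≡u-before-x (>⇒≢ p₂<p₃) p₃<x
  outcome-x-as-3 {p₁} {p₂} {p₃} (p₁<p₂ , p₂<p₃ , p₃<x , u₂<u₁ , u₁<ux , ux<u₃)
    | no p₁≢c | no p₂≢c | no p₃≢c with <-cmp (U p₁) (U c)
  ... | tri< u₁<uc _ _ = inj₁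
    (p₁<p₂ , p₂<p₃ , p₃<x ,
     transport-< v₂ v₁ u₂<u₁ , transport-< v₁ v-x u₁<uc , transport-< v-x v₃ (<-trans uc<ux ux<u₃))
    where
      v₁ : V p₁ ≡ U p₁
      v₁ = v≡u-before-x p₁≢c (<-trans p₁<p₂ (<-trans p₂<p₃ p₃<x))
      v₂ : V p₂ ≡ U p₂
      v₂ = v≡u-before-x p₂≢c (<-trans p₂<p₃ p₃<x)
      v₃ : V p₃ ≡ U p₃
      v₃ = v≡u-before-x p₃≢c p₃<x
  ... | tri≈ _ u₁≡uc _ = ⊥-elim (p₁≢c (⟨$⟩ʳ-injective u u₁≡uc))
  ... | tri> _ _ uc<u₁ = inj₂ record
    { quad        = p₁ , p₂ , p₃ , x′
    ; occurs-in-v = p₁<p₂ , p₂<p₃ , <-trans p₃<x x<x′ ,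
                    transport-< v₂ v₁ u₂<u₁ , transport-< v₁ v-x′ u₁<ux , transport-< v-x′ v₃ ux<u₃
    ; not-in-u    = λ (_ , _ , _ , _ , u₁<ux′ , _) → <-asym u₁<ux′ (above-uc-before-x p₁<x p₁≢c uc<u₁)
    ; restores    = trans (unrepair-∋x′ (inj₂ (inj₂ (inj₂ refl))))
                          (quad-cong (unswap-fixes-before-x p₁<x) (unswap-fixes-before-x p₂<x)
                                     (unswap-fixes-before-x p₃<x) unswap-x′)
    }
    where
      p₂<x : p₂ < x
      p₂<x = <-trans p₂<p₃ p₃<x
      p₁<x : p₁ < x
      p₁<x = <-trans p₁<p₂ p₂<x
      v₁ : V p₁ ≡ U p₁
      v₁ = v≡u-before-x p₁≢c p₁<x
      v₂ : V p₂ ≡ U p₂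
      v₂ = v≡u-before-x p₂≢c p₂<x
      v₃ : V p₃ ≡ U p₃
      v₃ = v≡u-before-x p₃≢c p₃<x

  outcome-x-between-4-and-3 : ∀ {p₁ p₂ p₃ p₄} → p₃ < x → x < p₄ →
    Occ2143 u (p₁ , p₂ , p₃ , p₄) → Outcome (p₁ , p₂ , p₃ , p₄)
  outcome-x-between-4-and-3 {p₁} {p₂} {p₃} {p₄} p₃<x x<p₄
                            (p₁<p₂ , p₂<p₃ , p₃<p₄ , u₂<u₁ , u₁<u₄ , u₄<u₃)
    with p₁ ≟ c | p₂ ≟ c | p₃ ≟ c | p₄ ≟ x′
  ... | yes refl | _ | _ | _ = ⊥-elim (<-asym (<-trans u₂<u₁ uc<ux′) (between p₁<p₂ (<-trans p₂<p₃ p₃<x)))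
  ... | no _ | no _ | yes refl | yes refl = ⊥-elim (<-asym u₄<u₃ uc<ux′)
  ... | no p₁≢c | no p₂≢c | yes refl | no p₄≢x′ = inj₁
    (p₁<p₂ , p₂<p₃ , p₃<p₄ ,
     transport-< v₂ v₁ u₂<u₁ , transport-< v₁ v₄ u₁<u₄ , transport-< v₄ v-c (<-trans u₄<u₃ uc<ux′))
    where
      v₁ : V p₁ ≡ U p₁
      v₁ = v≡u-before-x p₁≢c (<-trans p₁<p₂ (<-trans p₂<p₃ c<x))
      v₂ : V p₂ ≡ U p₂
      v₂ = v≡u-before-x p₂≢c (<-trans p₂<p₃ c<x)
      v₄ : V p₄ ≡ U p₄
      v₄ = v≡u-after-x p₄≢x′ x<p₄
  ... | no p₁≢c | yes refl | _ | yes refl with before p₁<p₂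
  ...   | inj₁ u₁<uc  = ⊥-elim (<-asym u₁<uc u₂<u₁)
  ...   | inj₂ ux′<u₁ = ⊥-elim (<-asym ux′<u₁ u₁<u₄)
  outcome-x-between-4-and-3 {p₁} {p₂} {p₃} {p₄} p₃<x x<p₄
                            (p₁<p₂ , p₂<p₃ , p₃<p₄ , u₂<u₁ , u₁<u₄ , u₄<u₃)
    | no p₁≢c | yes refl | _ | no p₄≢x′ with before p₁<p₂
  ... | inj₁ u₁<uc  = ⊥-elim (<-asym u₁<uc u₂<u₁)
  ... | inj₂ ux′<u₁ = inj₁
    (p₁<p₂ , p₂<p₃ , p₃<p₄ ,
     transport-< v-c v₁ ux′<u₁ , transport-< v₁ v₄ u₁<u₄ , transport-< v₄ v₃ u₄<u₃)
    where
      v₁ : V p₁ ≡ U p₁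
      v₁ = v≡u-before-x p₁≢c (<-trans p₁<p₂ c<x)
      v₃ : V p₃ ≡ U p₃
      v₃ = v≡u-before-x (>⇒≢ p₂<p₃) p₃<x
      v₄ : V p₄ ≡ U p₄
      v₄ = v≡u-after-x p₄≢x′ x<p₄
  outcome-x-between-4-and-3 {p₁} {p₂} {p₃} {p₄} p₃<x x<p₄
                            (p₁<p₂ , p₂<p₃ , p₃<p₄ , u₂<u₁ , u₁<u₄ , u₄<u₃)
    | no p₁≢c | no p₂≢c | no p₃≢c | no p₄≢x′ = inj₁
    (p₁<p₂ , p₂<p₃ , p₃<p₄ ,
     transport-< v₂ v₁ u₂<u₁ , transport-< v₁ v₄ u₁<u₄ , transport-< v₄ v₃ u₄<u₃)
    where
      v₁ : V p₁ ≡ U p₁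
      v₁ = v≡u-before-x p₁≢c (<-trans p₁<p₂ (<-trans p₂<p₃ p₃<x))
      v₂ : V p₂ ≡ U p₂
      v₂ = v≡u-before-x p₂≢c (<-trans p₂<p₃ p₃<x)
      v₃ : V p₃ ≡ U p₃
      v₃ = v≡u-before-x p₃≢c p₃<x
      v₄ : V p₄ ≡ U p₄
      v₄ = v≡u-after-x p₄≢x′ x<p₄
  outcome-x-between-4-and-3 {p₁} {p₂} {p₃} {p₄} p₃<x x<p₄
                            (p₁<p₂ , p₂<p₃ , p₃<p₄ , u₂<u₁ , u₁<u₄ , u₄<u₃)
    | no p₁≢c | no p₂≢c | no p₃≢c | yes refl with <-cmp (U x) (U p₃)
  ... | tri< ux<u₃ _ _ = inj₁
    (p₁<p₂ , p₂<p₃ , p₃<p₄ ,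
     transport-< v₂ v₁ u₂<u₁ , transport-< v₁ v-x′ (<-trans u₁<u₄ ux′<ux) , transport-< v-x′ v₃ ux<u₃)
    where
      v₁ : V p₁ ≡ U p₁
      v₁ = v≡u-before-x p₁≢c (<-trans p₁<p₂ (<-trans p₂<p₃ p₃<x))
      v₂ : V p₂ ≡ U p₂
      v₂ = v≡u-before-x p₂≢c (<-trans p₂<p₃ p₃<x)
      v₃ : V p₃ ≡ U p₃
      v₃ = v≡u-before-x p₃≢c p₃<x
  ... | tri≈ _ ux≡u₃ _ = ⊥-elim (>⇒≢ p₃<x (⟨$⟩ʳ-injective u ux≡u₃))
  ... | tri> _ _ u₃<ux = inj₂ record
    { quad        = p₁ , p₂ , p₃ , x
    ; occurs-in-v = p₁<p₂ , p₂<p₃ , p₃<x ,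
                    transport-< v₂ v₁ u₂<u₁ , transport-< v₁ v-x u₁<uc , transport-< v-x v₃ (<-trans uc<ux′ u₄<u₃)
    ; not-in-u    = λ (_ , _ , _ , _ , _ , ux<u₃) → <-asym ux<u₃ u₃<ux
    ; restores    = trans (unrepair-∌x′ (x′∉Q (<-trans p₁<x x<x′) (<-trans p₂<x x<x′) (<-trans p₃<x x<x′) x<x′))
                          (quad-cong (unshift-fixes-before-x p₁≢c p₁<x) (unshift-fixes-before-x p₂≢c p₂<x)
                                     (unshift-fixes-before-x p₃≢c p₃<x) unshift-x)
    }
    where
      p₂<x : p₂ < x
      p₂<x = <-trans p₂<p₃ p₃<x
      p₁<x : p₁ < x
      p₁<x = <-trans p₁<p₂ p₂<x
      u₁<uc : U p₁ < U c
      u₁<uc = below-uc-before-x p₁<x p₁≢c u₁<u₄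
      v₁ : V p₁ ≡ U p₁
      v₁ = v≡u-before-x p₁≢c p₁<x
      v₂ : V p₂ ≡ U p₂
      v₂ = v≡u-before-x p₂≢c p₂<x
      v₃ : V p₃ ≡ U p₃
      v₃ = v≡u-before-x p₃≢c p₃<x

  outcome-x-as-4 : ∀ {p₁ p₂ p₄} → Occ2143 u (p₁ , p₂ , x , p₄) → Outcome (p₁ , p₂ , x , p₄)
  outcome-x-as-4 {p₁} {p₂} {p₄} (p₁<p₂ , p₂<x , x<p₄ , u₂<u₁ , u₁<u₄ , u₄<ux)
    with p₁ ≟ c | p₂ ≟ c
  ... | yes refl | _ = ⊥-elim (<-asym (<-trans u₂<u₁ uc<ux′) (between p₁<p₂ p₂<x))
  ... | no p₁≢c | yes refl with before p₁<p₂
  ...   | inj₁ u₁<uc  = ⊥-elim (<-asym u₁<uc u₂<u₁)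
  ...   | inj₂ ux′<u₁ with <-cmp p₄ x′
  ...     | tri< p₄<x′ _ _ = ⊥-elim (<-asym (below-ux′-between-x-and-x′ x<p₄ p₄<x′) (<-trans ux′<u₁ u₁<u₄))
  ...     | tri≈ _ refl _  = ⊥-elim (<-irrefl refl (<-trans ux′<u₁ u₁<u₄))
  ...     | tri> _ _ x′<p₄ = inj₂ record
    { quad        = p₁ , c , x′ , p₄
    ; occurs-in-v = p₁<p₂ , c<x′ , x′<p₄ ,
                    transport-< v-c v₁ ux′<u₁ , transport-< v₁ v₄ u₁<u₄ , transport-< v₄ v-x′ u₄<ux
    ; not-in-u    = λ (_ , _ , _ , _ , _ , u₄<ux′) → <-asym u₄<ux′ (<-trans ux′<u₁ u₁<u₄)
    ; restores    = trans (unrepair-∋x′ (inj₂ (inj₂ (inj₁ refl))))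
                          (quad-cong (unswap-fixes-before-x p₁<x) (unswap-fixes-before-x c<x)
                                     unswap-x′ (unswap-fixes-after-x′ x′<p₄))
    }
    where
      p₁<x : p₁ < x
      p₁<x = <-trans p₁<p₂ c<x
      v₁ : V p₁ ≡ U p₁
      v₁ = v≡u-before-x p₁≢c p₁<x
      v₄ : V p₄ ≡ U p₄
      v₄ = v≡u-after-x′ x′<p₄
  outcome-x-as-4 {p₁} {p₂} {p₄} (p₁<p₂ , p₂<x , x<p₄ , u₂<u₁ , u₁<u₄ , u₄<ux)
    | no p₁≢c | no p₂≢c with p₄ ≟ x′
  ... | yes refl = inj₂ record
    { quad        = p₁ , p₂ , c , x
    ; occurs-in-v = p₁<p₂ , before-pivot-if-below-ux′ p₂<x p₂≢c (<-trans u₂<u₁ u₁<u₄) , c<x ,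
                    transport-< v₂ v₁ u₂<u₁ , transport-< v₁ v-x u₁<uc , transport-< v-x v-c uc<ux′
    ; not-in-u    = λ (_ , _ , _ , _ , _ , ux<uc) → <-asym ux<uc uc<ux
    ; restores    = trans (unrepair-∌x′ (x′∉Q (<-trans p₁<x x<x′) (<-trans p₂<x x<x′) c<x′ x<x′))
                          (quad-cong (unshift-fixes-before-x p₁≢c p₁<x) (unshift-fixes-before-x p₂≢c p₂<x)
                                     unshift-c unshift-x)
    }
    where
      p₁<x : p₁ < x
      p₁<x = <-trans p₁<p₂ p₂<x
      u₁<uc : U p₁ < U c
      u₁<uc = below-uc-before-x p₁<x p₁≢c u₁<u₄
      v₁ : V p₁ ≡ U p₁
      v₁ = v≡u-before-x p₁≢c p₁<x
      v₂ : V p₂ ≡ U p₂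
      v₂ = v≡u-before-x p₂≢c p₂<x
  ... | no p₄≢x′ with <-cmp (U p₄) (U c)
  ...   | tri< u₄<uc _ _ = inj₁
    (p₁<p₂ , p₂<x , x<p₄ ,
     transport-< v₂ v₁ u₂<u₁ , transport-< v₁ v₄ u₁<u₄ , transport-< v₄ v-x u₄<uc)
    where
      v₁ : V p₁ ≡ U p₁
      v₁ = v≡u-before-x p₁≢c (<-trans p₁<p₂ p₂<x)
      v₂ : V p₂ ≡ U p₂
      v₂ = v≡u-before-x p₂≢c p₂<x
      v₄ : V p₄ ≡ U p₄
      v₄ = v≡u-after-x p₄≢x′ x<p₄
  ...   | tri≈ _ u₄≡uc _ = ⊥-elim (>⇒≢ (<-trans c<x x<p₄) (⟨$⟩ʳ-injective u u₄≡uc))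
  ...   | tri> _ _ uc<u₄ with <-cmp p₄ x′
  ...     | tri≈ _ p₄≡x′ _ = ⊥-elim (p₄≢x′ p₄≡x′)
  ...     | tri< p₄<x′ _ _ = inj₂ record
    { quad        = p₁ , p₂ , c , p₄
    ; occurs-in-v = p₁<p₂ , before-pivot-if-below-ux′ p₂<x p₂≢c (<-trans u₂<u₁ (<-trans u₁<u₄ u₄<ux′)) ,
                    <-trans c<x x<p₄ ,
                    transport-< v₂ v₁ u₂<u₁ , transport-< v₁ v₄ u₁<u₄ , transport-< v₄ v-c u₄<ux′
    ; not-in-u    = λ (_ , _ , _ , _ , _ , u₄<uc) → <-asym u₄<uc uc<u₄
    ; restores    = trans (unrepair-∌x′ (x′∉Q (<-trans p₁<x x<x′) (<-trans p₂<x x<x′) c<x′ p₄<x′))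
                          (quad-cong (unshift-fixes-before-x p₁≢c p₁<x) (unshift-fixes-before-x p₂≢c p₂<x)
                                     unshift-c (unshift-fixes (>⇒≢ (<-trans c<x x<p₄)) (>⇒≢ x<p₄) p₄≢x′))
    }
    where
      p₁<x : p₁ < x
      p₁<x = <-trans p₁<p₂ p₂<x
      u₄<ux′ : U p₄ < U x′
      u₄<ux′ = below-ux′-between-x-and-x′ x<p₄ p₄<x′
      v₁ : V p₁ ≡ U p₁
      v₁ = v≡u-before-x p₁≢c p₁<x
      v₂ : V p₂ ≡ U p₂
      v₂ = v≡u-before-x p₂≢c p₂<x
      v₄ : V p₄ ≡ U p₄
      v₄ = v≡u-after-x p₄≢x′ x<p₄
  ...     | tri> _ _ x′<p₄ = inj₂ record
    { quad        = p₁ , p₂ , x′ , p₄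
    ; occurs-in-v = p₁<p₂ , <-trans p₂<x x<x′ , x′<p₄ ,
                    transport-< v₂ v₁ u₂<u₁ , transport-< v₁ v₄ u₁<u₄ , transport-< v₄ v-x′ u₄<ux
    ; not-in-u    = λ (_ , _ , _ , _ , _ , u₄<ux′) → not-below-ux′ u₄<ux′
    ; restores    = trans (unrepair-∋x′ (inj₂ (inj₂ (inj₁ refl))))
                          (quad-cong (unswap-fixes-before-x p₁<x) (unswap-fixes-before-x p₂<x)
                                     unswap-x′ (unswap-fixes-after-x′ x′<p₄))
    }
    where
      p₁<x : p₁ < x
      p₁<x = <-trans p₁<p₂ p₂<x
      v₁ : V p₁ ≡ U p₁
      v₁ = v≡u-before-x p₁≢c p₁<x
      v₂ : V p₂ ≡ U p₂
      v₂ = v≡u-before-x p₂≢c p₂<x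
      v₄ : V p₄ ≡ U p₄
      v₄ = v≡u-after-x′ x′<p₄
      not-below-ux′ : ¬ U p₄ < U x′
      not-below-ux′ u₄<ux′ with after x<x′ x′<p₄
      ... | inj₁ u₄<uc  = <-asym u₄<uc uc<u₄
      ... | inj₂ ux′<u₄ = <-asym u₄<ux′ ux′<u₄

  outcome : ∀ q → Occ2143 u q → Outcome q
  outcome (p₁ , p₂ , p₃ , p₄) o with <-cmp p₃ x | <-cmp p₄ x
  ... | tri> _ _ x<p₃ | _              = inj₁ (preserved-after-x x<p₃ o)
  ... | tri≈ _ refl _ | _              = outcome-x-as-4 o
  ... | tri< _ _ _    | tri< p₄<x _ _  = inj₁ (preserved-before-x p₄<x o)
  ... | tri< _ _ _    | tri≈ _ refl _  = outcome-x-as-3 o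
  ... | tri< p₃<x _ _ | tri> _ _ x<p₄  = outcome-x-between-4-and-3 p₃<x x<p₄ o

  retract : Quad {n} → Quad {n}
  retract q with occ2143? u q
  ... | yes _ = q
  ... | no  _ = unrepair q

  retract-occurrence : ∀ {q} → Occ2143 u q → retract q ≡ q
  retract-occurrence {q} o with occ2143? u q
  ... | yes _  = refl
  ... | no ¬o  = ⊥-elim (¬o o)

  retract-non-occurrence : ∀ {q} → ¬ Occ2143 u q → retract q ≡ unrepair q
  retract-non-occurrence {q} ¬o with occ2143? u q
  ... | yes o = ⊥-elim (¬o o)
  ... | no  _ = refl

  N2143-≤ : N2143 u ℕ.≤ N2143 v
  N2143-≤ = length-filter-≤ (occ2143? u) (occ2143? v) retract quads-unique cover
    where
      cover : ∀ {q} → q ∈ quads → Occ2143 u q → ∃ λ q′ → q′ ∈ quads × Occ2143 v q′ × retract q′ ≡ q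
      cover {q} _ o with outcome q o
      ... | inj₁ o′ = q , ∈-quads q , o′ , retract-occurrence o
      ... | inj₂ r  = quad , ∈-quads quad , occurs-in-v , trans (retract-non-occurrence not-in-u) restores
        where open Replacement r

N2143-cong : {u v : Perm n} → u ≈ v → N2143 u ≡ N2143 v
N2143-cong {u = u} {v} u≈v =
  cong length (filter-≐ (occ2143? u) (occ2143? v) (transfer {u = u} {v} u≈v , transfer {u = v} {u} (sym ∘ u≈v)) quads)
  where
    transfer : ∀ {u v : Perm n} → u ≈ v → ∀ {q} → Occ2143 u q → Occ2143 v q
    transfer u≈v {p₁ , p₂ , p₃ , p₄} (p₁<p₂ , p₂<p₃ , p₃<p₄ , u₂<u₁ , u₁<u₄ , u₄<u₃) =
      p₁<p₂ , p₂<p₃ , p₃<p₄ ,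
      transport-< (sym (u≈v p₂)) (sym (u≈v p₁)) u₂<u₁ ,
      transport-< (sym (u≈v p₁)) (sym (u≈v p₄)) u₁<u₄ ,
      transport-< (sym (u≈v p₄)) (sym (u≈v p₃)) u₄<u₃

N2143-≤-transition-at-only-pivot : (u : Perm n) {x y c : Fin n} → Accessible u x y → Pivot u x y c →
  (∀ {d} → Pivot u x y d → d ≡ c) → N2143 u ℕ.≤ N2143 (transition u x y c)
N2143-≤-transition-at-only-pivot u {x} {y} {c} accessible piv onlyPivot =
  ValueCycle.N2143-≤ u (transition u x y c) c<x x<x′
    (transition-at-pivot u x y c (>⇒≢ c<x′) (>⇒≢ x<x′)) (transition-at-x u x y c (>⇒≢ c<x) (<⇒≢ x<x′))
    (transition-at-x′ u x y c) (transition-elsewhere u x y c)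
    (transport-< refl ux′≡y uc<y) (transport-< ux′≡y refl y<ux)
    (transport-< ux′≡y refl ∘₂ between-pivot-and-x)
    (Sum.map₂ (transport-< ux′≡y refl) ∘ before-pivot)
    after-x
  where
    open OnlyPivot u accessible piv onlyPivot
    c<x′ : c < x′
    c<x′ = <-trans c<x x<x′
    ux′≡y : u ⟨$⟩ʳ x′ ≡ y
    ux′≡y = inverseʳ u

proposition3p3 : (n : ℕ) (w u u' : Perm n) →
    Node w u → Child u u' → (∀ v → Child u v → v ≈ u') →
    N2143 u' ≥ N2143 u
proposition3p3 n w u u' _ (¬vexillary , x , y , accessible , c , piv , u'≈) onlyChild = begin
  N2143 u                     ≤⟨ N2143-≤-transition-at-only-pivot u accessible piv onlyPivot ⟩
  N2143 (transition u x y c)  ≡⟨ N2143-cong {u = transition u x y c} {u'} (sym ∘ u'≈) ⟩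
  N2143 u'                    ∎
  where
    open ℕ.≤-Reasoning
    onlyPivot : ∀ {d} → Pivot u x y d → d ≡ c
    onlyPivot {d} pd = transition-injective u (proj₁ piv) (proj₁ pd) (proj₂ (proj₁ (proj₁ accessible)))
      (λ i → trans (onlyChild (transition u x y d) (¬vexillary , x , y , accessible , d , pd , λ _ → refl) i) (u'≈ i))
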